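{- Let $Q$ be a connected loop-less quiver with $m$ vertices and $n$ arrows. Then $$\mathrm{rad}(q_Q)=\{x\in\mathbb{Z}^n\mid \Phi_Q^{\mathrm{tr}}x=x\},\qquad \mathrm{rad}_{re}(q_Q)=\{I(Q^\dagger)^{\mathrm{tr}}y\mid y\in\mathbb{Z}^m,\ \Lambda_Q^{\mathrm{tr}}y=y\}.$$
   Context: A quiver $Q$ has vertices $\{1,\dots,m\}$, arrows $\{1,\dots,n\}$, source/target maps $s,t$; loop-less: $s(i)\neq t(i)$; connected: underlying graph connected. $I(Q)$ is the $m\times n$ matrix with $i$-th column $\mathbf{e}_{s(i)}-\mathbf{e}_{t(i)}$; $q_Q(x)=\frac12\|I(Q)x\|^2$ for $x\in\mathbb{Z}^n$; $G_Q=I(Q)^{\mathrm{tr}}I(Q)$ and $\check G_Q$ is the upper triangular matrix with $\check G_Q+\check G_Q^{\mathrm{tr}}=G_Q$. The inverse quiver $Q^\dagger$ has incidence matrix $I(Q^\dagger)=I(Q)\check G_Q^{ -1}$. The Coxeter–Gram matrix is $\Phi_Q=\mathrm{Id}_n-I(Q)^{\mathrm{tr}}I(Q)\check G_Q^{ -1}$ and the Coxeter–Laplacian is $\Lambda_Q=\mathrm{Id}_m-I(Q)\check G_Q^{ -1}I(Q)^{\mathrm{tr}}$. For $q=q_Q$: $\mathrm{rad}(q)=\{x\in\mathbb{Z}^n\mid G_Qx=0\}$ and the reduced radical is $\mathrm{rad}_{re}(q)=\{x\in\mathrm{rad}(q)\mid y^{\mathrm{tr}}\check G_Qx=0\text{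 for all }y\in\mathrm{rad}(q)\}$. -}

module Defs where

open import Data.Nat using (ℕ; zero; suc)
open import Data.Fin using (Fin; zero; suc; _<_; _≟_)
open import Data.Fin.Properties using (<-cmp)
open import Data.Integer using (ℤ; +_; _+_; _-_; _*_; 0ℤ; 1ℤ)
open import Data.Integer.DivMod using (_/_)
open import Data.Product using (Σ; _×_; _,_)
open import Relation.Nullary using (¬_; yes; no)
open import Relation.Binary.PropositionalEquality using (_≡_; _≢_)
open import Relation.Binary using (tri<; tri≈; tri>)

Vec : ℕ → Set
Vec n = Fin n → ℤ

Mat : ℕ → ℕ → Set
Mat m n = Fin m → Fin n → ℤ

Σ[<_]_ : (n : ℕ) → (Fin n → ℤ) → ℤ
Σ[< zero ] f = 0ℤ
Σ[< suc n ] f = f zero + Σ[< n ] (λ i → f (suc i))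

infix 4 _≗v_
_≗v_ : ∀ {n} → Vec n → Vec n → Set
x ≗v y = ∀ i → x i ≡ y i

infix 4 _≗m_
_≗m_ : ∀ {m n} → Mat m n → Mat m n → Set
A ≗m B = ∀ i j → A i j ≡ B i j

zeroV : ∀ {n} → Vec n
zeroV _ = 0ℤ

idMat : ∀ n → Mat n n
idMat n i j with i ≟ j
... | yes _ = 1ℤ
... | no _ = 0ℤ

_ᵀ : ∀ {m n} → Mat m n → Mat n m
(A ᵀ) j i = A i j

_·_ : ∀ {m n k} → Mat m n → Mat n k → Mat m k
_·_ {n = n} A B i j = Σ[< n ] (λ l → A i l * B l j)

_$$_ : ∀ {m n} → Mat m n → Vec n → Vec m
_$$_ {n = n} A x i = Σ[< n ] (λ l → A i l * x l)

_-ᴹ_ : ∀ {m n} → Mat m n → Mat m n → Mat m n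
(A -ᴹ B) i j = A i j - B i j

dot : ∀ {n} → Vec n → Vec n → ℤ
dot {n} y x = Σ[< n ] (λ l → y l * x l)

IsInverse : ∀ {n} → Mat n n → Mat n n → Set
IsInverse {n} A B = ((A · B) ≗m idMat n) × ((B · A) ≗m idMat n)

record Quiver (m n : ℕ) : Set where
  field
    s t : Fin n → Fin m
open Quiver public

LoopLess : ∀ {m n} → Quiver m n → Set
LoopLess Q = ∀ i → s Q i ≢ t Q i

data Walk {m n} (Q : Quiver m n) : Fin m → Fin m → Set where
  here  : ∀ {u} → Walk Q u u
  fwd   : ∀ {v} (i : Fin n) → Walk Q (t Q i) v → Walk Q (s Q i) v
  bwd   : ∀ {v} (i : Fin n) → Walk Q (s Q i) v → Walk Q (t Q i) v

Connected : ∀ {m n} → Quiver m n → Set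
Connected Q = ∀ u v → Walk Q u v

incidence : ∀ {m n} → Quiver m n → Mat m n
incidence Q v i = idMat _ (s Q i) v - idMat _ (t Q i) v

gram : ∀ {m n} → Quiver m n → Mat n n
gram Q = (incidence Q ᵀ) · incidence Q

-- upper triangular Gram matrix: the upper triangular matrix with Ǧ + Ǧ^tr = G
upperGram : ∀ {m n} → Quiver m n → Mat n n
upperGram Q i j with <-cmp i j
... | tri< _ _ _ = gram Q i j
... | tri≈ _ _ _ = gram Q i j / (+ 2)
... | tri> _ _ _ = 0ℤ

-- the following take a matrix Ginv which is the inverse of Ǧ_Q
-- incidence matrix of the inverse quiver: I(Q†) = I(Q) Ǧ_Q^{-1}
incidenceInv : ∀ {m n} → Quiver m n → Mat n n → Mat m n
incidenceInv Q Ginv = incidence Q · Ginv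

coxeterGram : ∀ {m n} → Quiver m n → Mat n n → Mat n n
coxeterGram {n = n} Q Ginv = idMat n -ᴹ (((incidence Q ᵀ) · incidence Q) · Ginv)

coxeterLaplacian : ∀ {m n} → Quiver m n → Mat n n → Mat m m
coxeterLaplacian {m = m} Q Ginv = idMat m -ᴹ ((incidence Q · Ginv) · (incidence Q ᵀ))

InRad : ∀ {m n} → Quiver m n → Vec n → Set
InRad Q x = (gram Q $$ x) ≗v zeroV

InRadRe : ∀ {m n} → Quiver m n → Vec n → Set
InRadRe Q x = InRad Q x × (∀ y → InRad Q y → dot y (upperGram Q $$ x) ≡ 0ℤ)

{-# OPTIONS --safe #-}
module Submission where

-- Write I for the incidence matrix, G = Iᵀ I and Ǧ for its upper triangular half. On a
-- loop-less quiver G has diagonal 2, so Ǧ + Ǧᵀ = G. Since xᵀ G x = ‖I x‖², the radical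
-- is the cycle space ker I, and Φᵀ x = x − Ǧ⁻ᵀ G x is fixed exactly on it. For x in the
-- radical, zᵀ Ǧ x = − zᵀ Ǧᵀ x for every radical z, so x is in the reduced radical iff
-- Ǧᵀ x is orthogonal to all cycles; on a connected quiver this means Ǧᵀ x = Iᵀ y for a
-- potential y, obtained by integrating Ǧᵀ x along walks to a root. Then x = I(Q†)ᵀ y
-- with I x = 0, which is the condition Λᵀ y = y − I I(Q†)ᵀ y = y.

open import Defs
open import Data.Nat as ℕ using (ℕ; zero; suc; z≤n)
open import Data.Fin using (Fin; zero; suc; _≟_; _<_)
open import Data.Fin.Properties using (<-cmp; <-asym; <-irrefl; ¬Fin0)
open import Data.Integer using (ℤ; +_; -[1+_]; _+_; _-_; _*_; -_; ∣_∣; 0ℤ; 1ℤ; -1ℤ; _≤_; +≤+)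
open import Data.Integer.DivMod using (_/_)
import Data.Integer.Properties as ℤ
open import Data.Integer.Tactic.RingSolver using (solve-∀)
open import Algebra.Properties.Semiring.Sum ℤ.+-*-semiring
  using (sum; ∑-distrib-+; ∑-comm; *-distribˡ-sum; *-distribʳ-sum)
open import Data.Product using (Σ; _×_; _,_; proj₁; proj₂)
open import Data.Sum using (inj₁; inj₂)
open import Data.Empty using (⊥-elim)
open import Function.Bundles using (_⇔_; mk⇔; Equivalence)
open import Function.Properties.Equivalence using () renaming (trans to ⇔-trans)
open import Relation.Binary using (Tri; tri<; tri≈; tri>)
open import Relation.Binary.PropositionalEquality
open import Relation.Nullary using (yes; no; ¬_)

private variable
  m n k : ℕ

Σ≡sum : ∀ n (f : Fin n → ℤ) → Σ[< n ] f ≡ sum f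
Σ≡sum zero    f = refl
Σ≡sum (suc n) f = cong (_+_ (f zero)) (Σ≡sum n (λ i → f (suc i)))

Σ-cong : {f g : Fin n → ℤ} → (∀ i → f i ≡ g i) → Σ[< n ] f ≡ Σ[< n ] g
Σ-cong {zero}  e = refl
Σ-cong {suc n} e = cong₂ _+_ (e zero) (Σ-cong (λ i → e (suc i)))

Σ-zero : {f : Fin n → ℤ} → (∀ i → f i ≡ 0ℤ) → Σ[< n ] f ≡ 0ℤ
Σ-zero {zero}  e = refl
Σ-zero {suc n} e = cong₂ _+_ (e zero) (Σ-zero (λ i → e (suc i)))

Σ-distrib-+ : (f g : Fin n → ℤ) → Σ[< n ] (λ i → f i + g i) ≡ Σ[< n ] f + Σ[< n ] g
Σ-distrib-+ {n} f g = begin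
  Σ[< _ ] (λ i → f i + g i) ≡⟨ Σ≡sum n _ ⟩
  sum (λ i → f i + g i)     ≡⟨ ∑-distrib-+ f g ⟩
  sum f + sum g             ≡⟨ sym (cong₂ _+_ (Σ≡sum n f) (Σ≡sum n g)) ⟩
  Σ[< _ ] f + Σ[< _ ] g     ∎
  where open ≡-Reasoning

*-distribˡ-Σ : (c : ℤ) (f : Fin n → ℤ) → c * Σ[< n ] f ≡ Σ[< n ] (λ i → c * f i)
*-distribˡ-Σ {n} c f = trans (cong (c *_) (Σ≡sum n f)) (trans (*-distribˡ-sum c f) (sym (Σ≡sum n _)))

*-distribʳ-Σ : (c : ℤ) (f : Fin n → ℤ) → Σ[< n ] f * c ≡ Σ[< n ] (λ i → f i * c)
*-distribʳ-Σ {n} c f = trans (cong (_* c) (Σ≡sum n f)) (trans (*-distribʳ-sum c f) (sym (Σ≡sum n _)))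

neg-distrib-Σ : (f : Fin n → ℤ) → - Σ[< n ] f ≡ Σ[< n ] (λ i → - f i)
neg-distrib-Σ f = begin
  - Σ[< _ ] f                  ≡⟨ ℤ.-1*i≡-i _ ⟨
  -1ℤ * Σ[< _ ] f              ≡⟨ *-distribˡ-Σ -1ℤ f ⟩
  Σ[< _ ] (λ i → -1ℤ * f i)    ≡⟨ Σ-cong (λ i → ℤ.-1*i≡-i (f i)) ⟩
  Σ[< _ ] (λ i → - f i)        ∎
  where open ≡-Reasoning

Σ-distrib-- : (f g : Fin n → ℤ) → Σ[< n ] (λ i → f i - g i) ≡ Σ[< n ] f - Σ[< n ] g
Σ-distrib-- f g = trans (Σ-distrib-+ f (λ i → - g i)) (cong (_+_ (Σ[< _ ] f)) (sym (neg-distrib-Σ g)))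

Σ-comm : (f : Fin m → Fin n → ℤ) →
         Σ[< m ] (λ i → Σ[< n ] (f i)) ≡ Σ[< n ] (λ j → Σ[< m ] (λ i → f i j))
Σ-comm {m} {n} f = trans (Σ²≡sum² f) (trans (∑-comm f) (sym (Σ²≡sum² (λ j i → f i j))))
  where
  Σ²≡sum² : ∀ {m n} (g : Fin m → Fin n → ℤ) → Σ[< m ] (λ i → Σ[< n ] (g i)) ≡ sum (λ i → sum (g i))
  Σ²≡sum² {m} {n} g = trans (Σ-cong (λ i → Σ≡sum n (g i))) (Σ≡sum m _)

idMat-suc : (a b : Fin n) → idMat (suc n) (suc a) (suc b) ≡ idMat n a b
idMat-suc a b with a ≟ b
... | yes _ = refl
... | no _  = refl

idMat-diag : (a : Fin n) → idMat n a a ≡ 1ℤ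
idMat-diag a with a ≟ a
... | yes _ = refl
... | no a≢a = ⊥-elim (a≢a refl)

idMat-off : {a b : Fin n} → ¬ a ≡ b → idMat n a b ≡ 0ℤ
idMat-off {a = a} {b} a≢b with a ≟ b
... | yes a≡b = ⊥-elim (a≢b a≡b)
... | no _    = refl

idMat-sym : (a b : Fin n) → idMat n a b ≡ idMat n b a
idMat-sym a b with a ≟ b | b ≟ a
... | yes _   | yes _   = refl
... | yes a≡b | no b≢a  = ⊥-elim (b≢a (sym a≡b))
... | no a≢b  | yes b≡a = ⊥-elim (a≢b (sym b≡a))
... | no _    | no _    = refl

Σ-idMat : (a : Fin n) (f : Fin n → ℤ) → Σ[< n ] (λ j → idMat n a j * f j) ≡ f a
Σ-idMat {suc n} zero f = begin
  1ℤ * f zero + Σ[< n ] (λ j → 0ℤ * f (suc j)) ≡⟨ cong (_+_ (1ℤ * f zero)) (Σ-zero (λ j → ℤ.*-zeroˡ (f (suc j)))) ⟩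
  1ℤ * f zero + 0ℤ                             ≡⟨ ℤ.+-identityʳ _ ⟩
  1ℤ * f zero                                  ≡⟨ ℤ.*-identityˡ _ ⟩
  f zero                                       ∎
  where open ≡-Reasoning
Σ-idMat {suc n} (suc a) f = begin
  0ℤ * f zero + Σ[< n ] (λ j → idMat (suc n) (suc a) (suc j) * f (suc j))
    ≡⟨ cong₂ _+_ (ℤ.*-zeroˡ (f zero)) (Σ-cong (λ j → cong (_* f (suc j)) (idMat-suc a j))) ⟩
  0ℤ + Σ[< n ] (λ j → idMat n a j * f (suc j))
    ≡⟨ ℤ.+-identityˡ _ ⟩
  Σ[< n ] (λ j → idMat n a j * f (suc j))
    ≡⟨ Σ-idMat a (λ j → f (suc j)) ⟩
  f (suc a) ∎
  where open ≡-Reasoning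

*-distribˡ-- : ∀ a b c → a * (b - c) ≡ a * b - a * c
*-distribˡ-- = solve-∀

*-distribʳ-- : ∀ a b c → (b - c) * a ≡ b * a - c * a
*-distribʳ-- = solve-∀

square≡+∣∣² : ∀ a → a * a ≡ + (∣ a ∣ ℕ.* ∣ a ∣)
square≡+∣∣² (+ _)    = ℤ.+◃n≡+n _
square≡+∣∣² -[1+ _ ] = ℤ.+◃n≡+n _

square-nonneg : ∀ a → 0ℤ ≤ a * a
square-nonneg a = subst (0ℤ ≤_) (sym (square≡+∣∣² a)) (+≤+ z≤n)

square≡0⇒≡0 : ∀ a → a * a ≡ 0ℤ → a ≡ 0ℤ
square≡0⇒≡0 a e with ℤ.i*j≡0⇒i≡0∨j≡0 a e
... | inj₁ a≡0 = a≡0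
... | inj₂ a≡0 = a≡0

nonneg-+≡0⇒≡0 : ∀ {a b} → 0ℤ ≤ a → 0ℤ ≤ b → a + b ≡ 0ℤ → a ≡ 0ℤ
nonneg-+≡0⇒≡0 {a} {b} 0≤a 0≤b e = ℤ.≤-antisym a≤0 0≤a
  where
  a≤0 : a ≤ 0ℤ
  a≤0 = subst₂ _≤_ (ℤ.+-identityʳ a) e (ℤ.+-monoʳ-≤ a 0≤b)

Σ-nonneg : {f : Fin n → ℤ} → (∀ i → 0ℤ ≤ f i) → 0ℤ ≤ Σ[< n ] f
Σ-nonneg {zero}  _   = ℤ.≤-refl
Σ-nonneg {suc n} 0≤f = ℤ.+-mono-≤ (0≤f zero) (Σ-nonneg (λ i → 0≤f (suc i)))

Σ-nonneg≡0⇒≡0 : {f : Fin n → ℤ} → (∀ i → 0ℤ ≤ f i) → Σ[< n ] f ≡ 0ℤ → ∀ i → f i ≡ 0ℤ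
Σ-nonneg≡0⇒≡0 {suc n} {f} 0≤f e = λ where
    zero    → head≡0
    (suc i) → Σ-nonneg≡0⇒≡0 (λ j → 0≤f (suc j)) tail≡0 i
  where
  0≤tail : 0ℤ ≤ Σ[< n ] (λ j → f (suc j))
  0≤tail = Σ-nonneg (λ j → 0≤f (suc j))
  head≡0 : f zero ≡ 0ℤ
  head≡0 = nonneg-+≡0⇒≡0 (0≤f zero) 0≤tail e
  tail≡0 : Σ[< n ] (λ j → f (suc j)) ≡ 0ℤ
  tail≡0 = nonneg-+≡0⇒≡0 0≤tail (0≤f zero) (trans (ℤ.+-comm _ (f zero)) e)

infixl 6 _+ᵛ_ _-ᵛ_

_+ᵛ_ : Vec n → Vec n → Vec n
(x +ᵛ y) i = x i + y i

_-ᵛ_ : Vec n → Vec n → Vec n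
(x -ᵛ y) i = x i - y i

basis : Fin n → Vec n
basis i = idMat _ i

dot-self≡0⇒≗0 : (v : Vec n) → dot v v ≡ 0ℤ → v ≗v zeroV
dot-self≡0⇒≗0 v e i = square≡0⇒≡0 (v i) (Σ-nonneg≡0⇒≡0 (λ j → square-nonneg (v j)) e i)

≗-ᵛ⇒fixed⇔≗0 : {v x u : Vec n} → v ≗v (x -ᵛ u) → v ≗v x ⇔ u ≗v zeroV
≗-ᵛ⇒fixed⇔≗0 {x = x} {u} v≗x-u = mk⇔
  (λ v≗x i → trans (sub-sub (x i) (u i))
                   (trans (cong (_-_ (x i)) (trans (sym (v≗x-u i)) (v≗x i))) (ℤ.+-inverseʳ (x i))))
  (λ u≗0 i → trans (v≗x-u i) (trans (cong (_-_ (x i)) (u≗0 i)) (ℤ.+-identityʳ (x i))))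
  where
  sub-sub : ∀ a b → b ≡ a - (a - b)
  sub-sub = solve-∀

$$-congˡ : {A B : Mat m n} → A ≗m B → (x : Vec n) → (A $$ x) ≗v (B $$ x)
$$-congˡ A≗B x i = Σ-cong (λ l → cong (_* x l) (A≗B i l))

$$-congʳ : (A : Mat m n) {x y : Vec n} → x ≗v y → (A $$ x) ≗v (A $$ y)
$$-congʳ A x≗y i = Σ-cong (λ l → cong (A i l *_) (x≗y l))

$$-zero : (A : Mat m n) {x : Vec n} → x ≗v zeroV → (A $$ x) ≗v zeroV
$$-zero A x≗0 i = Σ-zero (λ l → trans (cong (A i l *_) (x≗0 l)) (ℤ.*-zeroʳ (A i l)))

$$-distrib-+ᵛ : (A : Mat m n) (x y : Vec n) → (A $$ (x +ᵛ y)) ≗v ((A $$ x) +ᵛ (A $$ y))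
$$-distrib-+ᵛ {n = n} A x y i = trans (Σ-cong (λ l → ℤ.*-distribˡ-+ (A i l) (x l) (y l))) (Σ-distrib-+ {n} _ _)

$$-distrib--ᵛ : (A : Mat m n) (x y : Vec n) → (A $$ (x -ᵛ y)) ≗v ((A $$ x) -ᵛ (A $$ y))
$$-distrib--ᵛ {n = n} A x y i = trans (Σ-cong (λ l → *-distribˡ-- (A i l) (x l) (y l))) (Σ-distrib-- {n} _ _)

-ᴹ-$$ : (A B : Mat m n) (x : Vec n) → ((A -ᴹ B) $$ x) ≗v ((A $$ x) -ᵛ (B $$ x))
-ᴹ-$$ {n = n} A B x i = trans (Σ-cong (λ l → *-distribʳ-- (x l) (A i l) (B i l))) (Σ-distrib-- {n} _ _)

idMatᵀ-$$ : (x : Vec n) → ((idMat n ᵀ) $$ x) ≗v x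
idMatᵀ-$$ x i = trans (Σ-cong (λ l → cong (_* x l) (idMat-sym l i))) (Σ-idMat i x)

$$-basis : (A : Mat m n) (j : Fin n) → (A $$ basis j) ≗v (λ i → A i j)
$$-basis A j i = trans (Σ-cong (λ l → ℤ.*-comm (A i l) _)) (Σ-idMat j (A i))

·-$$ : (A : Mat m n) (B : Mat n k) (x : Vec k) → ((A · B) $$ x) ≗v (A $$ (B $$ x))
·-$$ {n = n} {k = k} A B x i = begin
  Σ[< k ] (λ j → Σ[< n ] (λ l → A i l * B l j) * x j)  ≡⟨ Σ-cong (λ j → *-distribʳ-Σ {n} (x j) _) ⟩
  Σ[< k ] (λ j → Σ[< n ] (λ l → A i l * B l j * x j))  ≡⟨ Σ-comm {k} {n} _ ⟩
  Σ[< n ] (λ l → Σ[< k ] (λ j → A i l * B l j * x j))  ≡⟨ Σ-cong (λ l → Σ-cong (λ j → ℤ.*-assoc (A i l) (B l j) (x j))) ⟩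
  Σ[< n ] (λ l → Σ[< k ] (λ j → A i l * (B l j * x j))) ≡⟨ Σ-cong (λ l → *-distribˡ-Σ {k} (A i l) _) ⟨
  Σ[< n ] (λ l → A i l * (B $$ x) l)                    ∎
  where open ≡-Reasoning

ᵀ-anti-· : (A : Mat m n) (B : Mat n k) → ((A · B) ᵀ) ≗m ((B ᵀ) · (A ᵀ))
ᵀ-anti-· A B i j = Σ-cong (λ l → ℤ.*-comm (A j l) (B l i))

ᵀ-inverse : (A B : Mat n n) → (B · A) ≗m idMat n → ((A ᵀ) · (B ᵀ)) ≗m idMat n
ᵀ-inverse A B BA≗id i j =
  trans (sym (ᵀ-anti-· B A i j)) (trans (BA≗id j i) (idMat-sym j i))

inverse-$$ : (A B : Mat n n) → (A · B) ≗m idMat n → (x : Vec n) → (A $$ (B $$ x)) ≗v x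
inverse-$$ A B AB≗id x i = begin
  (A $$ (B $$ x)) i      ≡⟨ ·-$$ A B x i ⟨
  ((A · B) $$ x) i       ≡⟨ $$-congˡ AB≗id x i ⟩
  (idMat _ $$ x) i       ≡⟨ $$-congˡ idMat-sym x i ⟩
  ((idMat _ ᵀ) $$ x) i   ≡⟨ idMatᵀ-$$ x i ⟩
  x i                    ∎
  where open ≡-Reasoning

dot-congʳ : (y : Vec n) {x x′ : Vec n} → x ≗v x′ → dot y x ≡ dot y x′
dot-congʳ y x≗x′ = Σ-cong (λ l → cong (y l *_) (x≗x′ l))

dot-zeroʳ : (y : Vec n) {x : Vec n} → x ≗v zeroV → dot y x ≡ 0ℤ
dot-zeroʳ y x≗0 = Σ-zero (λ l → trans (cong (y l *_) (x≗0 l)) (ℤ.*-zeroʳ (y l)))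

dot-zeroˡ : {y : Vec n} (x : Vec n) → y ≗v zeroV → dot y x ≡ 0ℤ
dot-zeroˡ x y≗0 = Σ-zero (λ l → trans (cong (_* x l) (y≗0 l)) (ℤ.*-zeroˡ (x l)))

dot-distrib-+ᵛʳ : (y x x′ : Vec n) → dot y (x +ᵛ x′) ≡ dot y x + dot y x′
dot-distrib-+ᵛʳ {n} y x x′ = trans (Σ-cong (λ l → ℤ.*-distribˡ-+ (y l) (x l) (x′ l))) (Σ-distrib-+ {n} _ _)

dot-distrib--ᵛˡ : (y y′ x : Vec n) → dot (y -ᵛ y′) x ≡ dot y x - dot y′ x
dot-distrib--ᵛˡ {n} y y′ x = trans (Σ-cong (λ l → *-distribʳ-- (x l) (y l) (y′ l))) (Σ-distrib-- {n} _ _)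

dot-basisˡ : (i : Fin n) (x : Vec n) → dot (basis i) x ≡ x i
dot-basisˡ = Σ-idMat

dot-$$ : (A : Mat m n) (y : Vec m) (x : Vec n) → dot y (A $$ x) ≡ dot ((A ᵀ) $$ y) x
dot-$$ {m} {n} A y x = begin
  Σ[< m ] (λ i → y i * Σ[< n ] (λ l → A i l * x l))   ≡⟨ Σ-cong (λ i → *-distribˡ-Σ {n} (y i) _) ⟩
  Σ[< m ] (λ i → Σ[< n ] (λ l → y i * (A i l * x l))) ≡⟨ Σ-comm {m} {n} _ ⟩
  Σ[< n ] (λ l → Σ[< m ] (λ i → y i * (A i l * x l))) ≡⟨ Σ-cong (λ l → Σ-cong (λ i → rearrange (y i) (A i l) (x l))) ⟩
  Σ[< n ] (λ l → Σ[< m ] (λ i → A i l * y i * x l))   ≡⟨ Σ-cong (λ l → *-distribʳ-Σ {m} (x l) _) ⟨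
  Σ[< n ] (λ l → ((A ᵀ) $$ y) l * x l)                ∎
  where
  open ≡-Reasoning
  rearrange : ∀ a b c → a * (b * c) ≡ b * a * c
  rearrange = solve-∀

IsCycle : Quiver m n → Vec n → Set
IsCycle Q z = (incidence Q $$ z) ≗v zeroV

IsCoboundary : Quiver m n → Vec n → Set
IsCoboundary {m} Q w = Σ (Vec m) λ y → ((incidence Q ᵀ) $$ y) ≗v w

module _ (Q : Quiver m n) where

  gram-$$ : (x : Vec n) → (gram Q $$ x) ≗v ((incidence Q ᵀ) $$ (incidence Q $$ x))
  gram-$$ = ·-$$ (incidence Q ᵀ) (incidence Q)

  gram-sym : (i j : Fin n) → gram Q i j ≡ gram Q j i
  gram-sym i j = Σ-cong (λ l → ℤ.*-comm (incidence Q l i) (incidence Q l j))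

  incidenceᵀ-$$ : (y : Vec m) (i : Fin n) → ((incidence Q ᵀ) $$ y) i ≡ y (s Q i) - y (t Q i)
  incidenceᵀ-$$ y i = begin
    Σ[< m ] (λ v → (idMat m (s Q i) v - idMat m (t Q i) v) * y v)
      ≡⟨ Σ-cong (λ v → *-distribʳ-- (y v) (idMat m (s Q i) v) (idMat m (t Q i) v)) ⟩
    Σ[< m ] (λ v → idMat m (s Q i) v * y v - idMat m (t Q i) v * y v)
      ≡⟨ Σ-distrib-- {m} _ _ ⟩
    Σ[< m ] (λ v → idMat m (s Q i) v * y v) - Σ[< m ] (λ v → idMat m (t Q i) v * y v)
      ≡⟨ cong₂ _-_ (Σ-idMat (s Q i) y) (Σ-idMat (t Q i) y) ⟩
    y (s Q i) - y (t Q i) ∎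
    where open ≡-Reasoning

  InRad⇔IsCycle : (x : Vec n) → InRad Q x ⇔ IsCycle Q x
  InRad⇔IsCycle x = mk⇔ to (λ Ix≗0 i → trans (gram-$$ x i) ($$-zero (incidence Q ᵀ) Ix≗0 i))
    where
    to : InRad Q x → IsCycle Q x
    to Gx≗0 = dot-self≡0⇒≗0 (incidence Q $$ x) (begin
      dot (incidence Q $$ x) (incidence Q $$ x)                ≡⟨ dot-$$ (incidence Q) (incidence Q $$ x) x ⟩
      dot ((incidence Q ᵀ) $$ (incidence Q $$ x)) x            ≡⟨ Σ-cong (λ l → cong (_* x l) (gram-$$ x l)) ⟨
      dot (gram Q $$ x) x                                       ≡⟨ dot-zeroˡ x Gx≗0 ⟩
      0ℤ ∎)
      where open ≡-Reasoning

  cycle-⊥-incidenceᵀ : {z : Vec n} → IsCycle Q z → (y : Vec m) → dot z ((incidence Q ᵀ) $$ y) ≡ 0ℤ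
  cycle-⊥-incidenceᵀ {z} Iz≗0 y = trans (dot-$$ (incidence Q ᵀ) z y) (dot-zeroˡ y Iz≗0)

  walkFlow : {u v : Fin m} → Walk Q u v → Vec n
  walkFlow here      = zeroV
  walkFlow (fwd i p) = basis i +ᵛ walkFlow p
  walkFlow (bwd i p) = walkFlow p -ᵛ basis i

  incidence-walkFlow : {u v : Fin m} (p : Walk Q u v) → (incidence Q $$ walkFlow p) ≗v (basis u -ᵛ basis v)
  incidence-walkFlow {u} here k = trans ($$-zero (incidence Q) (λ _ → refl) k) (sym (ℤ.+-inverseʳ (basis u k)))
  incidence-walkFlow {v = v} (fwd i p) k = begin
    (incidence Q $$ (basis i +ᵛ walkFlow p)) k
      ≡⟨ $$-distrib-+ᵛ (incidence Q) (basis i) (walkFlow p) k ⟩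
    (incidence Q $$ basis i) k + (incidence Q $$ walkFlow p) k
      ≡⟨ cong₂ _+_ ($$-basis (incidence Q) i k) (incidence-walkFlow p k) ⟩
    (basis (s Q i) k - basis (t Q i) k) + (basis (t Q i) k - basis v k)
      ≡⟨ ℤ.+-minus-telescope (basis (s Q i) k) _ _ ⟩
    basis (s Q i) k - basis v k ∎
    where open ≡-Reasoning
  incidence-walkFlow {v = v} (bwd i p) k = begin
    (incidence Q $$ (walkFlow p -ᵛ basis i)) k
      ≡⟨ $$-distrib--ᵛ (incidence Q) (walkFlow p) (basis i) k ⟩
    (incidence Q $$ walkFlow p) k - (incidence Q $$ basis i) k
      ≡⟨ cong₂ _-_ (incidence-walkFlow p k) ($$-basis (incidence Q) i k) ⟩
    (basis (s Q i) k - basis v k) - (basis (s Q i) k - basis (t Q i) k)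
      ≡⟨ cancel (basis (s Q i) k) (basis (t Q i) k) (basis v k) ⟩
    basis (t Q i) k - basis v k ∎
    where
    open ≡-Reasoning
    cancel : ∀ a b c → (a - c) - (a - b) ≡ b - c
    cancel = solve-∀

  rooted-⊥cycles⇒coboundary : (r : Fin m) → (∀ u → Walk Q u r) → (w : Vec n) →
    (∀ z → IsCycle Q z → dot z w ≡ 0ℤ) → IsCoboundary Q w
  rooted-⊥cycles⇒coboundary r reach w w⊥cycles =
    y , λ i → trans (incidenceᵀ-$$ y i)
                    (ℤ.i-j≡0⇒i≡j (y (s Q i) - y (t Q i)) (w i) (trans (sym (dot-loop i)) (w⊥cycles (loop i) (loop-cycle i))))
    where
    flow : Fin m → Vec n
    flow u = walkFlow (reach u)

    y : Vec m
    y u = dot (flow u) w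

    -- the closed walk s i → r → t i → s i, whose last step runs against arrow i
    loop : Fin n → Vec n
    loop i = (flow (s Q i) -ᵛ flow (t Q i)) -ᵛ basis i

    loop-cycle : ∀ i → IsCycle Q (loop i)
    loop-cycle i k = begin
      (incidence Q $$ loop i) k
        ≡⟨ $$-distrib--ᵛ (incidence Q) (flow (s Q i) -ᵛ flow (t Q i)) (basis i) k ⟩
      (incidence Q $$ (flow (s Q i) -ᵛ flow (t Q i))) k - (incidence Q $$ basis i) k
        ≡⟨ cong₂ _-_ ($$-distrib--ᵛ (incidence Q) (flow (s Q i)) (flow (t Q i)) k) ($$-basis (incidence Q) i k) ⟩
      ((incidence Q $$ flow (s Q i)) k - (incidence Q $$ flow (t Q i)) k) - (basis (s Q i) k - basis (t Q i) k)
        ≡⟨ cong (λ a → a - (basis (s Q i) k - basis (t Q i) k))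
                (cong₂ _-_ (incidence-walkFlow (reach (s Q i)) k) (incidence-walkFlow (reach (t Q i)) k)) ⟩
      ((basis (s Q i) k - basis r k) - (basis (t Q i) k - basis r k)) - (basis (s Q i) k - basis (t Q i) k)
        ≡⟨ cancel (basis (s Q i) k) (basis (t Q i) k) (basis r k) ⟩
      0ℤ ∎
      where
      open ≡-Reasoning
      cancel : ∀ a b c → ((a - c) - (b - c)) - (a - b) ≡ 0ℤ
      cancel = solve-∀

    dot-loop : ∀ i → dot (loop i) w ≡ (y (s Q i) - y (t Q i)) - w i
    dot-loop i = trans (dot-distrib--ᵛˡ (flow (s Q i) -ᵛ flow (t Q i)) (basis i) w)
                       (cong₂ _-_ (dot-distrib--ᵛˡ (flow (s Q i)) (flow (t Q i)) w) (dot-basisˡ i w))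

⊥cycles⇒coboundary : (Q : Quiver m n) → Connected Q → (w : Vec n) →
  (∀ z → IsCycle Q z → dot z w ≡ 0ℤ) → IsCoboundary Q w
⊥cycles⇒coboundary {zero}  Q _         _ _ = (λ ()) , λ i → ⊥-elim (¬Fin0 (s Q i))
⊥cycles⇒coboundary {suc m} Q connected   = rooted-⊥cycles⇒coboundary Q zero (λ u → connected u zero)

module _ (Q : Quiver m n) (loopless : LoopLess Q) where

  gram-diag : (i : Fin n) → gram Q i i ≡ + 2
  gram-diag i = begin
    gram Q i i
      ≡⟨ incidenceᵀ-$$ Q (λ v → incidence Q v i) i ⟩
    (idMat m (s Q i) (s Q i) - idMat m (t Q i) (s Q i)) - (idMat m (s Q i) (t Q i) - idMat m (t Q i) (t Q i))
      ≡⟨ cong₂ _-_ (cong₂ _-_ (idMat-diag (s Q i)) (idMat-off (λ t≡s → loopless i (sym t≡s))))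
                   (cong₂ _-_ (idMat-off (loopless i)) (idMat-diag (t Q i))) ⟩
    (1ℤ - 0ℤ) - (0ℤ - 1ℤ) ∎
    where open ≡-Reasoning

  upperGram-above : {i j : Fin n} → i < j → upperGram Q i j ≡ gram Q i j
  upperGram-above {i} {j} i<j with <-cmp i j
  ... | tri< _ _ _   = refl
  ... | tri≈ _ i≡j _ = ⊥-elim (<-irrefl i≡j i<j)
  ... | tri> _ _ j<i = ⊥-elim (<-asym i<j j<i)

  upperGram-below : {i j : Fin n} → j < i → upperGram Q i j ≡ 0ℤ
  upperGram-below {i} {j} j<i with <-cmp i j
  ... | tri< i<j _ _ = ⊥-elim (<-asym i<j j<i)
  ... | tri≈ _ i≡j _ = ⊥-elim (<-irrefl (sym i≡j) j<i)
  ... | tri> _ _ _   = refl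

  upperGram-diag : (i : Fin n) → upperGram Q i i ≡ 1ℤ
  upperGram-diag i with <-cmp i i
  ... | tri< i<i _ _ = ⊥-elim (<-irrefl refl i<i)
  ... | tri≈ _ _ _   = cong (_/ + 2) (gram-diag i)
  ... | tri> _ _ i<i = ⊥-elim (<-irrefl refl i<i)

  upperGram-+ᵀ : (i j : Fin n) → upperGram Q i j + upperGram Q j i ≡ gram Q i j
  upperGram-+ᵀ i j = by-cmp (<-cmp i j)
    where
    by-cmp : ∀ {i j} → Tri (i < j) (i ≡ j) (j < i) → upperGram Q i j + upperGram Q j i ≡ gram Q i j
    by-cmp (tri< i<j _ _)      = trans (cong₂ _+_ (upperGram-above i<j) (upperGram-below i<j)) (ℤ.+-identityʳ _)
    by-cmp {i} (tri≈ _ refl _) = trans (cong₂ _+_ (upperGram-diag i) (upperGram-diag i)) (sym (gram-diag i))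
    by-cmp {i} {j} (tri> _ _ j<i) = trans (cong₂ _+_ (upperGram-below j<i) (upperGram-above j<i))
                                          (trans (ℤ.+-identityˡ _) (gram-sym Q j i))

  upperGram-$$-+ᵀ : (x : Vec n) → ((upperGram Q $$ x) +ᵛ ((upperGram Q ᵀ) $$ x)) ≗v (gram Q $$ x)
  upperGram-$$-+ᵀ x i = trans (sym (Σ-distrib-+ {n} _ _)) (Σ-cong (λ l →
    trans (sym (ℤ.*-distribʳ-+ (x l) (upperGram Q i l) (upperGram Q l i))) (cong (_* x l) (upperGram-+ᵀ i l))))

  dot-upperGram-+ᵀ : {x : Vec n} → InRad Q x → (z : Vec n) →
                     dot z (upperGram Q $$ x) + dot z ((upperGram Q ᵀ) $$ x) ≡ 0ℤ
  dot-upperGram-+ᵀ {x} Gx≗0 z =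
    trans (sym (dot-distrib-+ᵛʳ z _ _)) (trans (dot-congʳ z (upperGram-$$-+ᵀ x)) (dot-zeroʳ z Gx≗0))

  InRadRe⇔InRad×coboundary : Connected Q → (x : Vec n) →
    InRadRe Q x ⇔ (InRad Q x × IsCoboundary Q ((upperGram Q ᵀ) $$ x))
  InRadRe⇔InRad×coboundary connected x = mk⇔ to from
    where
    to : InRadRe Q x → InRad Q x × IsCoboundary Q ((upperGram Q ᵀ) $$ x)
    to (Gx≗0 , Ǧx⊥rad) = Gx≗0 , ⊥cycles⇒coboundary Q connected ((upperGram Q ᵀ) $$ x) Ǧᵀx⊥cycles
      where
      Ǧᵀx⊥cycles : ∀ z → IsCycle Q z → dot z ((upperGram Q ᵀ) $$ x) ≡ 0ℤ
      Ǧᵀx⊥cycles z Iz≗0 = trans (sym (ℤ.+-identityˡ _))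
        (trans (cong (_+ dot z ((upperGram Q ᵀ) $$ x)) (sym (Ǧx⊥rad z z∈rad))) (dot-upperGram-+ᵀ Gx≗0 z))
        where
        z∈rad : InRad Q z
        z∈rad = Equivalence.from (InRad⇔IsCycle Q z) Iz≗0
    from : InRad Q x × IsCoboundary Q ((upperGram Q ᵀ) $$ x) → InRadRe Q x
    from (Gx≗0 , y , Iᵀy≗Ǧᵀx) = Gx≗0 , Ǧx⊥rad
      where
      Ǧx⊥rad : ∀ z → InRad Q z → dot z (upperGram Q $$ x) ≡ 0ℤ
      Ǧx⊥rad z Gz≗0 = trans (sym (ℤ.+-identityʳ _))
        (trans (cong (_+_ (dot z (upperGram Q $$ x))) (sym Ǧᵀx⊥z)) (dot-upperGram-+ᵀ Gx≗0 z))
        where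
        Ǧᵀx⊥z : dot z ((upperGram Q ᵀ) $$ x) ≡ 0ℤ
        Ǧᵀx⊥z = trans (dot-congʳ z (λ i → sym (Iᵀy≗Ǧᵀx i)))
                      (cycle-⊥-incidenceᵀ Q (Equivalence.to (InRad⇔IsCycle Q z) Gz≗0) y)

module _ (Q : Quiver m n) (Ginv : Mat n n) (Ǧ⁻¹ : IsInverse (upperGram Q) Ginv) where

  upperGramᵀ-Ginvᵀ : (x : Vec n) → ((upperGram Q ᵀ) $$ ((Ginv ᵀ) $$ x)) ≗v x
  upperGramᵀ-Ginvᵀ = inverse-$$ (upperGram Q ᵀ) (Ginv ᵀ) (ᵀ-inverse (upperGram Q) Ginv (proj₂ Ǧ⁻¹))

  Ginvᵀ-upperGramᵀ : (x : Vec n) → ((Ginv ᵀ) $$ ((upperGram Q ᵀ) $$ x)) ≗v x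
  Ginvᵀ-upperGramᵀ = inverse-$$ (Ginv ᵀ) (upperGram Q ᵀ) (ᵀ-inverse Ginv (upperGram Q) (proj₁ Ǧ⁻¹))

  coxeterGramᵀ-$$ : (x : Vec n) → ((coxeterGram Q Ginv ᵀ) $$ x) ≗v (x -ᵛ ((Ginv ᵀ) $$ (gram Q $$ x)))
  coxeterGramᵀ-$$ x i = begin
    ((coxeterGram Q Ginv ᵀ) $$ x) i
      ≡⟨ -ᴹ-$$ (idMat n ᵀ) ((gram Q · Ginv) ᵀ) x i ⟩
    ((idMat n ᵀ) $$ x) i - (((gram Q · Ginv) ᵀ) $$ x) i
      ≡⟨ cong₂ _-_ (idMatᵀ-$$ x i) ($$-congˡ (ᵀ-anti-· (gram Q) Ginv) x i) ⟩
    x i - (((Ginv ᵀ) · (gram Q ᵀ)) $$ x) i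
      ≡⟨ cong (_-_ (x i)) (trans (·-$$ (Ginv ᵀ) (gram Q ᵀ) x i)
                                 ($$-congʳ (Ginv ᵀ) ($$-congˡ (λ a b → gram-sym Q b a) x) i)) ⟩
    x i - ((Ginv ᵀ) $$ (gram Q $$ x)) i ∎
    where open ≡-Reasoning

  incidenceInvᵀ-$$ : (y : Vec m) → ((incidenceInv Q Ginv ᵀ) $$ y) ≗v ((Ginv ᵀ) $$ ((incidence Q ᵀ) $$ y))
  incidenceInvᵀ-$$ y i =
    trans ($$-congˡ (ᵀ-anti-· (incidence Q) Ginv) y i) (·-$$ (Ginv ᵀ) (incidence Q ᵀ) y i)

  coxeterLaplacianᵀ-$$ : (y : Vec m) →
    ((coxeterLaplacian Q Ginv ᵀ) $$ y) ≗v (y -ᵛ (incidence Q $$ ((incidenceInv Q Ginv ᵀ) $$ y)))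
  coxeterLaplacianᵀ-$$ y k = begin
    ((coxeterLaplacian Q Ginv ᵀ) $$ y) k
      ≡⟨ -ᴹ-$$ (idMat m ᵀ) ((incidenceInv Q Ginv · (incidence Q ᵀ)) ᵀ) y k ⟩
    ((idMat m ᵀ) $$ y) k - (((incidenceInv Q Ginv · (incidence Q ᵀ)) ᵀ) $$ y) k
      ≡⟨ cong₂ _-_ (idMatᵀ-$$ y k) ($$-congˡ (ᵀ-anti-· (incidenceInv Q Ginv) (incidence Q ᵀ)) y k) ⟩
    y k - ((incidence Q · (incidenceInv Q Ginv ᵀ)) $$ y) k
      ≡⟨ cong (_-_ (y k)) (·-$$ (incidence Q) (incidenceInv Q Ginv ᵀ) y k) ⟩
    y k - (incidence Q $$ ((incidenceInv Q Ginv ᵀ) $$ y)) k ∎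
    where open ≡-Reasoning

  InRad⇔coxeterGramᵀ-fixed : (x : Vec n) → InRad Q x ⇔ ((coxeterGram Q Ginv ᵀ) $$ x) ≗v x
  InRad⇔coxeterGramᵀ-fixed x = mk⇔
    (λ Gx≗0 → Equivalence.from fixed⇔ ($$-zero (Ginv ᵀ) Gx≗0))
    (λ Φᵀx≗x i → trans (sym (upperGramᵀ-Ginvᵀ (gram Q $$ x) i))
                       ($$-zero (upperGram Q ᵀ) (Equivalence.to fixed⇔ Φᵀx≗x) i))
    where
    fixed⇔ : ((coxeterGram Q Ginv ᵀ) $$ x) ≗v x ⇔ ((Ginv ᵀ) $$ (gram Q $$ x)) ≗v zeroV
    fixed⇔ = ≗-ᵛ⇒fixed⇔≗0 (coxeterGramᵀ-$$ x)

  coxeterLaplacianᵀ-fixed⇔IsCycle : (y : Vec m) →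
    ((coxeterLaplacian Q Ginv ᵀ) $$ y) ≗v y ⇔ IsCycle Q ((incidenceInv Q Ginv ᵀ) $$ y)
  coxeterLaplacianᵀ-fixed⇔IsCycle y = ≗-ᵛ⇒fixed⇔≗0 (coxeterLaplacianᵀ-$$ y)

  InRadRe⇔coxeterLaplacianᵀ-fixed : LoopLess Q → Connected Q → (x : Vec n) →
    InRadRe Q x ⇔ Σ (Vec m) (λ y → (((coxeterLaplacian Q Ginv ᵀ) $$ y) ≗v y)
                                   × (x ≗v ((incidenceInv Q Ginv ᵀ) $$ y)))
  InRadRe⇔coxeterLaplacianᵀ-fixed loopless connected x =
    ⇔-trans (InRadRe⇔InRad×coboundary Q loopless connected x) (mk⇔ to from)
    where
    to : InRad Q x × IsCoboundary Q ((upperGram Q ᵀ) $$ x) →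
         Σ (Vec m) (λ y → (((coxeterLaplacian Q Ginv ᵀ) $$ y) ≗v y) × (x ≗v ((incidenceInv Q Ginv ᵀ) $$ y)))
    to (Gx≗0 , y , Iᵀy≗Ǧᵀx) = y , Equivalence.from (coxeterLaplacianᵀ-fixed⇔IsCycle y) cycle , x≗I†ᵀy
      where
      x≗I†ᵀy : x ≗v ((incidenceInv Q Ginv ᵀ) $$ y)
      x≗I†ᵀy i = begin
        x i                                           ≡⟨ Ginvᵀ-upperGramᵀ x i ⟨
        ((Ginv ᵀ) $$ ((upperGram Q ᵀ) $$ x)) i        ≡⟨ $$-congʳ (Ginv ᵀ) Iᵀy≗Ǧᵀx i ⟨
        ((Ginv ᵀ) $$ ((incidence Q ᵀ) $$ y)) i        ≡⟨ incidenceInvᵀ-$$ y i ⟨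
        ((incidenceInv Q Ginv ᵀ) $$ y) i              ∎
        where open ≡-Reasoning
      cycle : IsCycle Q ((incidenceInv Q Ginv ᵀ) $$ y)
      cycle k = trans (sym ($$-congʳ (incidence Q) x≗I†ᵀy k))
                      (Equivalence.to (InRad⇔IsCycle Q x) Gx≗0 k)
    from : Σ (Vec m) (λ y → (((coxeterLaplacian Q Ginv ᵀ) $$ y) ≗v y) × (x ≗v ((incidenceInv Q Ginv ᵀ) $$ y))) →
           InRad Q x × IsCoboundary Q ((upperGram Q ᵀ) $$ x)
    from (y , Λᵀy≗y , x≗I†ᵀy) = Equivalence.from (InRad⇔IsCycle Q x) Ix≗0 , y , Iᵀy≗Ǧᵀx
      where
      Ix≗0 : IsCycle Q x
      Ix≗0 k = trans ($$-congʳ (incidence Q) x≗I†ᵀy k)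
                     (Equivalence.to (coxeterLaplacianᵀ-fixed⇔IsCycle y) Λᵀy≗y k)
      Iᵀy≗Ǧᵀx : ((incidence Q ᵀ) $$ y) ≗v ((upperGram Q ᵀ) $$ x)
      Iᵀy≗Ǧᵀx i = begin
        ((incidence Q ᵀ) $$ y) i                                  ≡⟨ upperGramᵀ-Ginvᵀ ((incidence Q ᵀ) $$ y) i ⟨
        ((upperGram Q ᵀ) $$ ((Ginv ᵀ) $$ ((incidence Q ᵀ) $$ y))) i ≡⟨ $$-congʳ (upperGram Q ᵀ) (incidenceInvᵀ-$$ y) i ⟨
        ((upperGram Q ᵀ) $$ ((incidenceInv Q Ginv ᵀ) $$ y)) i     ≡⟨ $$-congʳ (upperGram Q ᵀ) x≗I†ᵀy i ⟨
        ((upperGram Q ᵀ) $$ x) i                                   ∎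
        where open ≡-Reasoning

lemma2p3 : ∀ {m n} (Q : Quiver m n) → LoopLess Q → Connected Q →
    (Ginv : Mat n n) → IsInverse (upperGram Q) Ginv →
    (∀ (x : Vec n) → InRad Q x ⇔ ((coxeterGram Q Ginv ᵀ) $$ x) ≗v x)
    × (∀ (x : Vec n) → InRadRe Q x ⇔
         Σ (Vec m) (λ y → (((coxeterLaplacian Q Ginv ᵀ) $$ y) ≗v y)
                          × (x ≗v ((incidenceInv Q Ginv ᵀ) $$ y))))
lemma2p3 Q loopless connected Ginv Ǧ⁻¹ =
  InRad⇔coxeterGramᵀ-fixed Q Ginv Ǧ⁻¹ , InRadRe⇔coxeterLaplacianᵀ-fixed Q Ginv Ǧ⁻¹ loopless connected
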